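{- Let $G$ be a finite simple unmixed graph and $x\in V(G)$. The following are equivalent: (a) $x$ is an extendable vertex; (b) $|N_G(x)\setminus N_G(S)|\ge 1$ for every stable set $S$ of $G\setminus N_G[x]$; (c) $x$ is a shedding vertex; (d) $x$ is a critical vertex and $G\setminus x$ is unmixed.
   Context: Unmixed (= well-covered): all maximal stable sets have the same cardinality. $\beta(H)$ is the maximum size of a stable set, $\tau(H)$ the minimum size of a vertex cover. $N_G(S)$ is the set of vertices adjacent to some vertex of $S$, $N_G[x]=N_G(x)\cup\{x\}$, and $G\setminus X$ is the induced subgraph on $V(G)\setminus X$. $x$ is extendable if $G$ and $G\setminus x$ are both well-covered and $\beta(G)=\beta(G\setminus x)$. $x$ is critical if $\tau(G\setminus x)<\tau(G)$. $x$ is a shedding vertex if no stable set of $G\setminus N_G[x]$ is a maximal stable set of $G\setminus x$. -}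

module Defs where

open import Data.Nat using (ℕ; _≤_; _<_)
open import Data.Bool using (Bool; true; false; _∧_)
open import Data.Fin using (Fin)
open import Data.Fin.Subset using (Subset; _∈_; _∉_; _⊆_; ∁; ⁅_⁆; _∪_; _─_; ∣_∣; ⊤)
open import Data.Vec using (tabulate)
open import Data.List using (allFin)
open import Data.Bool.ListAction using (any)
open import Data.Sum using (_⊎_)
open import Data.Product using (Σ; ∃; _×_; _,_)
open import Relation.Binary.PropositionalEquality using (_≡_)
open import Relation.Nullary using (¬_)

record Graph (n : ℕ) : Set where
  field
    adj    : Fin n → Fin n → Bool
    sym    : ∀ u v → adj u v ≡ adj v u
    irrefl : ∀ v → adj v v ≡ false

open Graph public

module _ {n : ℕ} (G : Graph n) where

  Adj : Fin n → Fin n → Set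
  Adj u v = adj G u v ≡ true

  N : Subset n → Subset n
  N S = tabulate (λ v → any (λ u → Data.Vec.lookup S u ∧ adj G u v) (allFin n))

  N[_] : Fin n → Subset n
  N[ x ] = N ⁅ x ⁆ ∪ ⁅ x ⁆

  -- Induced subgraphs are represented by their vertex set W ⊆ V(G):
  -- G \ X corresponds to W = ∁ X.

  Stable : Subset n → Subset n → Set
  Stable W S = S ⊆ W × (∀ u v → u ∈ S → v ∈ S → ¬ Adj u v)

  MaximalStable : Subset n → Subset n → Set
  MaximalStable W S = Stable W S × (∀ T → Stable W T → S ⊆ T → T ⊆ S)

  Unmixed : Subset n → Set
  Unmixed W = ∀ S T → MaximalStable W S → MaximalStable W T → ∣ S ∣ ≡ ∣ T ∣

  IsBeta : Subset n → ℕ → Set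
  IsBeta W k = (Σ (Subset n) λ S → Stable W S × ∣ S ∣ ≡ k)
             × (∀ S → Stable W S → ∣ S ∣ ≤ k)

  VertexCover : Subset n → Subset n → Set
  VertexCover W C = C ⊆ W × (∀ u v → u ∈ W → v ∈ W → Adj u v → u ∈ C ⊎ v ∈ C)

  IsTau : Subset n → ℕ → Set
  IsTau W k = (Σ (Subset n) λ C → VertexCover W C × ∣ C ∣ ≡ k)
            × (∀ C → VertexCover W C → k ≤ ∣ C ∣)

  Extendable : Fin n → Set
  Extendable x = Unmixed ⊤ × Unmixed (∁ ⁅ x ⁆)
               × (∀ a b → IsBeta ⊤ a → IsBeta (∁ ⁅ x ⁆) b → a ≡ b)

  Critical : Fin n → Set
  Critical x = ∀ a b → IsTau (∁ ⁅ x ⁆) a → IsTau ⊤ b → a < b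

  Shedding : Fin n → Set
  Shedding x = ∀ S → Stable (∁ N[ x ]) S → ¬ MaximalStable (∁ ⁅ x ⁆) S

  CondB : Fin n → Set
  CondB x = ∀ S → Stable (∁ N[ x ]) S → 1 ≤ ∣ N ⁅ x ⁆ ─ N S ∣

-- If S is a maximal stable set of G ∖ x avoiding N[x], then S ∪ {x} is a maximal stable set
-- of G, so β(G) = β(G ∖ x) together with unmixedness of G and G ∖ x rules such S out; that is
-- (a) ⇒ (c). Conversely, for a shedding vertex every maximal stable set of G ∖ x stays maximal
-- in G, so G ∖ x inherits unmixedness and β from G. Condition (b) is shedding rephrased: a
-- stable set of G ∖ N[x] extends to a maximal one, which is maximal in G ∖ x unless some
-- neighbour of x outside its neighbourhood can be added. Finally Gallai's identity
-- τ + β = |V|, applied to G and to G ∖ x, makes β(G ∖ x) = β(G) equivalent to τ(G ∖ x) < τ(G).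
module Submission where

open import Defs hiding (sym)
open import Data.Bool using (true; false)
import Data.Bool.Properties as Bool
open import Data.Empty using (⊥-elim)
open import Data.Fin using (Fin)
open import Data.Fin.Properties using (_≟_; any?; all?)
open import Data.Fin.Subset using (Subset; _∈_; _∉_; _⊆_; _⊂_; _∪_; _─_; ∁; ⁅_⁆; ⊤; ⊥; ∣_∣; Nonempty)
open import Data.Fin.Subset.Properties
open import Data.List using (allFin)
open import Data.List.Membership.Propositional using (lose)
import Data.List.Membership.Propositional.Properties as List
import Data.List.Relation.Unary.Any as Any
import Data.List.Relation.Unary.Any.Properties as Any
open import Data.Nat using (ℕ; zero; suc; _+_; _∸_; _≤_)
import Data.Nat.Properties as ℕ
open import Data.Product using (∃; _×_; _,_; proj₁; proj₂)
open import Data.Sum using (_⊎_; inj₁; inj₂; [_,_]′)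
open import Data.Vec using ([]; _∷_; lookup)
open import Data.Vec.Base using (here; there)
import Data.Vec.Properties as Vec
open import Function using (_∘_; id)
open import Function.Bundles using (_⇔_; mk⇔; Equivalence)
open import Relation.Nullary using (¬_; Dec; yes; no; contradiction)
open import Relation.Nullary.Decidable using (_×-dec_; _→-dec_; ¬?)
open import Relation.Binary.PropositionalEquality
  using (_≡_; _≢_; refl; sym; trans; cong; subst; module ≡-Reasoning)

x∈p─q⇒x∉q : ∀ {m} (p q : Subset m) {x} → x ∈ p ─ q → x ∉ q
x∈p─q⇒x∉q (_ ∷ p) (true  ∷ q) (there x∈p─q) (there x∈q) = x∈p─q⇒x∉q p q x∈p─q x∈q
x∈p─q⇒x∉q (_ ∷ p) (false ∷ q) (there x∈p─q) (there x∈q) = x∈p─q⇒x∉q p q x∈p─q x∈q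
x∈p─q⇒x∉q (_ ∷ p) (false ∷ q) here ()

∣p─q∣+∣q∣≡∣p∣ : ∀ {m} (p q : Subset m) → q ⊆ p → ∣ p ─ q ∣ + ∣ q ∣ ≡ ∣ p ∣
∣p─q∣+∣q∣≡∣p∣ []          []          _   = refl
∣p─q∣+∣q∣≡∣p∣ (true  ∷ p) (true  ∷ q) q⊆p =
  trans (ℕ.+-suc ∣ p ─ q ∣ ∣ q ∣) (cong suc (∣p─q∣+∣q∣≡∣p∣ p q (drop-∷-⊆ q⊆p)))
∣p─q∣+∣q∣≡∣p∣ (false ∷ p) (true  ∷ q) q⊆p with q⊆p here
... | ()
∣p─q∣+∣q∣≡∣p∣ (true  ∷ p) (false ∷ q) q⊆p = cong suc (∣p─q∣+∣q∣≡∣p∣ p q (drop-∷-⊆ q⊆p))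
∣p─q∣+∣q∣≡∣p∣ (false ∷ p) (false ∷ q) q⊆p = ∣p─q∣+∣q∣≡∣p∣ p q (drop-∷-⊆ q⊆p)

x∈p⇒1≤∣p∣ : ∀ {m} {p : Subset m} {x} → x ∈ p → 1 ≤ ∣ p ∣
x∈p⇒1≤∣p∣ {p = p} {x} x∈p = subst (_≤ ∣ p ∣) (∣⁅x⁆∣≡1 x)
  (p⊆q⇒∣p∣≤∣q∣ λ y∈⁅x⁆ → subst (_∈ p) (sym (x∈⁅y⁆⇒x≡y x y∈⁅x⁆)) x∈p)

1≤∣p∣⇒Nonempty : ∀ {m} (p : Subset m) → 1 ≤ ∣ p ∣ → Nonempty p
1≤∣p∣⇒Nonempty {m} p 1≤∣p∣ with nonempty? p
... | yes ne = ne
... | no ¬ne = contradiction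
  (subst (1 ≤_) (trans (cong ∣_∣ (Empty-unique ¬ne)) (∣⊥∣≡0 m)) 1≤∣p∣) λ ()

p⊆q∧∣q∣≤∣p∣⇒q⊆p : ∀ {m} {p q : Subset m} → p ⊆ q → ∣ q ∣ ≤ ∣ p ∣ → q ⊆ p
p⊆q∧∣q∣≤∣p∣⇒q⊆p {p = p} p⊆q ∣q∣≤∣p∣ {x} x∈q with x ∈? p
... | yes x∈p = x∈p
... | no  x∉p = contradiction (p⊂q⇒∣p∣<∣q∣ (p⊆q , x , x∈q , x∉p)) (ℕ.≤⇒≯ ∣q∣≤∣p∣)

x∉p⇒p⊂p∪⁅x⁆ : ∀ {m} {p : Subset m} {x} → x ∉ p → p ⊂ p ∪ ⁅ x ⁆
x∉p⇒p⊂p∪⁅x⁆ {p = p} {x} x∉p = p⊆p∪q {p = p} ⁅ x ⁆ , x , x∈p∪q⁺ (inj₂ (x∈⁅x⁆ x)) , x∉p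

module _ {n : ℕ} (G : Graph n) where

  adj? : ∀ u v → Dec (Adj G u v)
  adj? u v = adj G u v Bool.≟ true

  Adj-sym : ∀ {u v} → Adj G u v → Adj G v u
  Adj-sym {u} {v} = trans (Graph.sym G v u)

  Adj-irrefl : ∀ {u} → ¬ Adj G u u
  Adj-irrefl {u} uu with trans (sym (irrefl G u)) uu
  ... | ()

  ∈N⁻ : ∀ S {v} → v ∈ N G S → ∃ λ u → u ∈ S × Adj G u v
  ∈N⁻ S {v} v∈NS
    with Any.satisfied (Any.any⁻ _ (allFin n) (Equivalence.from Bool.T-≡
           (trans (sym (Vec.lookup∘tabulate _ v)) (Vec.[]=⇒lookup v∈NS))))
  ... | u , T[u∈S∧uv] with Equivalence.to (Bool.T-∧ {lookup S u}) T[u∈S∧uv]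
  ... | T[u∈S] , T[uv] =
    u , Vec.lookup⇒[]= u S (Equivalence.to Bool.T-≡ T[u∈S]) , Equivalence.to Bool.T-≡ T[uv]

  ∈N⁺ : ∀ S {u v} → u ∈ S → Adj G u v → v ∈ N G S
  ∈N⁺ S {u} {v} u∈S uv = Vec.lookup⇒[]= v (N G S)
    (trans (Vec.lookup∘tabulate _ v)
      (Equivalence.to Bool.T-≡ (Any.any⁺ _ (lose (List.∈-allFin u)
        (Equivalence.from (Bool.T-∧ {lookup S u})
          (Equivalence.from Bool.T-≡ (Vec.[]=⇒lookup u∈S) , Equivalence.from Bool.T-≡ uv))))))

  ∈N⁅x⁆⁺ : ∀ {x v} → Adj G x v → v ∈ N G ⁅ x ⁆
  ∈N⁅x⁆⁺ {x} = ∈N⁺ ⁅ x ⁆ (x∈⁅x⁆ x)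

  ∈N⁅x⁆⁻ : ∀ {x v} → v ∈ N G ⁅ x ⁆ → Adj G x v
  ∈N⁅x⁆⁻ {x} {v} v∈N⁅x⁆ with ∈N⁻ ⁅ x ⁆ v∈N⁅x⁆
  ... | u , u∈⁅x⁆ , uv = subst (λ w → Adj G w v) (x∈⁅y⁆⇒x≡y x u∈⁅x⁆) uv

  Stable-mono : ∀ {W₁ W₂ S} → W₁ ⊆ W₂ → Stable G W₁ S → Stable G W₂ S
  Stable-mono W₁⊆W₂ (S⊆W₁ , indep) = W₁⊆W₂ ∘ S⊆W₁ , indep

  Stable-⊥ : ∀ W → Stable G W ⊥
  Stable-⊥ W = (λ v∈⊥ → contradiction v∈⊥ ∉⊥) , λ u v u∈⊥ _ _ → ∉⊥ u∈⊥

  stable? : ∀ W S → Dec (Stable G W S)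
  stable? W S with all? (λ v → (v ∈? S) →-dec (v ∈? W))
                 | all? (λ u → all? (λ v → (u ∈? S) →-dec ((v ∈? S) →-dec ¬? (adj? u v))))
  ... | yes S⊆W | yes indep = yes ((λ {v} → S⊆W v) , indep)
  ... | no S⊈W  | _         = no λ st → S⊈W λ v → proj₁ st
  ... | yes _   | no ¬indep = no (¬indep ∘ proj₂)

  Addable : Subset n → Subset n → Fin n → Set
  Addable W S v = v ∈ W × v ∉ S × (∀ u → u ∈ S → ¬ Adj G u v)

  addable? : ∀ W S v → Dec (Addable W S v)
  addable? W S v = (v ∈? W) ×-dec ¬? (v ∈? S) ×-dec all? (λ u → (u ∈? S) →-dec ¬? (adj? u v))

  Stable-∪⁅⁆ : ∀ {W S v} → Stable G W S → Addable W S v → Stable G W (S ∪ ⁅ v ⁆)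
  Stable-∪⁅⁆ {W} {S} {v} (S⊆W , indep) (v∈W , _ , v∉N[S]) = S∪v⊆W , indep′
    where
    S∪v⊆W : S ∪ ⁅ v ⁆ ⊆ W
    S∪v⊆W {u} u∈ with x∈p∪q⁻ S ⁅ v ⁆ u∈
    ... | inj₁ u∈S = S⊆W u∈S
    ... | inj₂ u∈v = subst (_∈ W) (sym (x∈⁅y⁆⇒x≡y v u∈v)) v∈W
    indep′ : ∀ u w → u ∈ S ∪ ⁅ v ⁆ → w ∈ S ∪ ⁅ v ⁆ → ¬ Adj G u w
    indep′ u w u∈ w∈ with x∈p∪q⁻ S ⁅ v ⁆ u∈ | x∈p∪q⁻ S ⁅ v ⁆ w∈
    ... | inj₁ u∈S | inj₁ w∈S = indep u w u∈S w∈S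
    ... | inj₁ u∈S | inj₂ w∈v rewrite x∈⁅y⁆⇒x≡y v w∈v = v∉N[S] u u∈S
    ... | inj₂ u∈v | inj₁ w∈S rewrite x∈⁅y⁆⇒x≡y v u∈v = v∉N[S] w w∈S ∘ Adj-sym
    ... | inj₂ u∈v | inj₂ w∈v rewrite x∈⁅y⁆⇒x≡y v u∈v | x∈⁅y⁆⇒x≡y v w∈v = Adj-irrefl

  MaximalStable⇒¬Addable : ∀ {W S v} → MaximalStable G W S → ¬ Addable W S v
  MaximalStable⇒¬Addable {W} {S} {v} (st , maximal) addable@(_ , v∉S , _) =
    v∉S (maximal _ (Stable-∪⁅⁆ st addable) (p⊆p∪q {p = S} ⁅ v ⁆) (x∈p∪q⁺ (inj₂ (x∈⁅x⁆ v))))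

  ¬Addable⇒MaximalStable : ∀ {W S} → Stable G W S → (∀ v → ¬ Addable W S v) → MaximalStable G W S
  ¬Addable⇒MaximalStable {W} {S} st ¬addable = st , T⊆S
    where
    T⊆S : ∀ T → Stable G W T → S ⊆ T → T ⊆ S
    T⊆S T (T⊆W , indepT) S⊆T {v} v∈T with v ∈? S
    ... | yes v∈S = v∈S
    ... | no  v∉S = ⊥-elim (¬addable v (T⊆W v∈T , v∉S , λ u u∈S → indepT u v (S⊆T u∈S) v∈T))

  ¬MaximalStable⇒Addable : ∀ {W S} → Stable G W S → ¬ MaximalStable G W S → ∃ (Addable W S)
  ¬MaximalStable⇒Addable {W} {S} st ¬maximal with any? (addable? W S)
  ... | yes addable = addable
  ... | no ¬addable = contradiction (¬Addable⇒MaximalStable st (λ v → ¬addable ∘ (v ,_))) ¬maximal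

  -- The fuel k bounds the number of vertices that can still be added.
  extendToMaximal′ : ∀ W S k → n ≤ ∣ S ∣ + k → Stable G W S →
                    ∃ λ T → MaximalStable G W T × S ⊆ T
  extendToMaximal′ W S k n≤∣S∣+k st with any? (addable? W S)
  ... | no ¬addable = S , ¬Addable⇒MaximalStable st (λ v → ¬addable ∘ (v ,_)) , id
  extendToMaximal′ W S zero n≤∣S∣+0 st | yes (v , _ , v∉S , _) = contradiction
    (ℕ.≤-<-trans (subst (n ≤_) (ℕ.+-identityʳ _) n≤∣S∣+0) (p⊂q⇒∣p∣<∣q∣ (x∉p⇒p⊂p∪⁅x⁆ v∉S)))
    (ℕ.≤⇒≯ (∣p∣≤n (S ∪ ⁅ v ⁆)))
  extendToMaximal′ W S (suc k) n≤∣S∣+1+k st | yes (v , addable@(_ , v∉S , _))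
    with extendToMaximal′ W (S ∪ ⁅ v ⁆) k n≤∣S∪v∣+k (Stable-∪⁅⁆ st addable)
    where
    n≤∣S∪v∣+k : n ≤ ∣ S ∪ ⁅ v ⁆ ∣ + k
    n≤∣S∪v∣+k = ℕ.≤-trans n≤∣S∣+1+k (subst (_≤ ∣ S ∪ ⁅ v ⁆ ∣ + k) (sym (ℕ.+-suc ∣ S ∣ k))
                  (ℕ.+-monoˡ-≤ k (p⊂q⇒∣p∣<∣q∣ (x∉p⇒p⊂p∪⁅x⁆ v∉S))))
  ... | T , maximalT , S∪v⊆T = T , maximalT , S∪v⊆T ∘ p⊆p∪q {p = S} ⁅ v ⁆

  extendToMaximal : ∀ {W S} → Stable G W S → ∃ λ T → MaximalStable G W T × S ⊆ T
  extendToMaximal {W} {S} = extendToMaximal′ W S n (ℕ.m≤n+m n ∣ S ∣)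

  β-exists′ : ∀ W k → (∀ S → Stable G W S → ∣ S ∣ ≤ k) → ∃ (IsBeta G W)
  β-exists′ W k bound with anySubset? (λ S → stable? W S ×-dec (∣ S ∣ ℕ.≟ k))
  ... | yes witness = k , witness , bound
  β-exists′ W zero    bound | no ¬witness = contradiction (⊥ , Stable-⊥ W , ∣⊥∣≡0 n) ¬witness
  β-exists′ W (suc k) bound | no ¬witness = β-exists′ W k λ S st →
    ℕ.≤-pred (ℕ.≤∧≢⇒< (bound S st) (λ ∣S∣≡1+k → ¬witness (S , st , ∣S∣≡1+k)))

  β-exists : ∀ W → ∃ (IsBeta G W)
  β-exists W = β-exists′ W n (λ S _ → ∣p∣≤n S)

  IsBeta-mono : ∀ {W₁ W₂ b₁ b₂} → W₁ ⊆ W₂ → IsBeta G W₁ b₁ → IsBeta G W₂ b₂ → b₁ ≤ b₂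
  IsBeta-mono W₁⊆W₂ ((S , st , refl) , _) (_ , bound) = bound S (Stable-mono W₁⊆W₂ st)

  IsBeta⇒MaximalStable : ∀ {W b} (β : IsBeta G W b) → MaximalStable G W (proj₁ (proj₁ β))
  IsBeta⇒MaximalStable ((S , st , refl) , bound) = st , λ T stT S⊆T → p⊆q∧∣q∣≤∣p∣⇒q⊆p S⊆T (bound T stT)

  Unmixed⇒∣MaximalStable∣≡β : ∀ {W S b} → Unmixed G W → MaximalStable G W S → IsBeta G W b → ∣ S ∣ ≡ b
  Unmixed⇒∣MaximalStable∣≡β unmixed maximalS β@((_ , _ , ∣S₀∣≡b) , _) =
    trans (unmixed _ _ maximalS (IsBeta⇒MaximalStable β)) ∣S₀∣≡b

  Stable⇒VertexCover-─ : ∀ {W S} → Stable G W S → VertexCover G W (W ─ S)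
  Stable⇒VertexCover-─ {W} {S} (_ , indep) = p─q⊆p W S , covers
    where
    covers : ∀ u v → u ∈ W → v ∈ W → Adj G u v → u ∈ W ─ S ⊎ v ∈ W ─ S
    covers u v u∈W v∈W uv with u ∈? S | v ∈? S
    ... | no  u∉S | _        = inj₁ (x∈p∧x∉q⇒x∈p─q u∈W u∉S)
    ... | yes _   | no  v∉S  = inj₂ (x∈p∧x∉q⇒x∈p─q v∈W v∉S)
    ... | yes u∈S | yes v∈S  = contradiction uv (indep u v u∈S v∈S)

  VertexCover⇒Stable-─ : ∀ {W C} → VertexCover G W C → Stable G W (W ─ C)
  VertexCover⇒Stable-─ {W} {C} (_ , covers) = p─q⊆p W C , λ u v u∈ v∈ uv →
    [ x∈p─q⇒x∉q W C u∈ , x∈p─q⇒x∉q W C v∈ ]′ (covers u v (p─q⊆p W C u∈) (p─q⊆p W C v∈) uv)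

  τ+∣Stable∣≤∣W∣ : ∀ {W t S} → IsTau G W t → Stable G W S → t + ∣ S ∣ ≤ ∣ W ∣
  τ+∣Stable∣≤∣W∣ {W} {t} {S} (_ , minimal) st@(S⊆W , _) =
    subst (t + ∣ S ∣ ≤_) (∣p─q∣+∣q∣≡∣p∣ W S S⊆W)
      (ℕ.+-monoˡ-≤ ∣ S ∣ (minimal _ (Stable⇒VertexCover-─ st)))

  ∣W∣≤∣VertexCover∣+β : ∀ {W b C} → IsBeta G W b → VertexCover G W C → ∣ W ∣ ≤ ∣ C ∣ + b
  ∣W∣≤∣VertexCover∣+β {W} {b} {C} (_ , bound) cover@(C⊆W , _) =
    subst (_≤ ∣ C ∣ + b) (trans (ℕ.+-comm ∣ C ∣ ∣ W ─ C ∣) (∣p─q∣+∣q∣≡∣p∣ W C C⊆W))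
      (ℕ.+-monoʳ-≤ ∣ C ∣ (bound _ (VertexCover⇒Stable-─ cover)))

  -- Gallai's identity: complements of stable sets are exactly the vertex covers.
  τ+β≡∣W∣ : ∀ {W t b} → IsTau G W t → IsBeta G W b → t + b ≡ ∣ W ∣
  τ+β≡∣W∣ τ@((C , cover , refl) , _) β@((S , st , refl) , _) =
    ℕ.≤-antisym (τ+∣Stable∣≤∣W∣ τ st) (∣W∣≤∣VertexCover∣+β β cover)

  τ-exists : ∀ W → ∃ (IsTau G W)
  τ-exists W with β-exists W
  ... | b , β@((S , st@(S⊆W , _) , refl) , _) =
    ∣ W ─ S ∣ , (W ─ S , Stable⇒VertexCover-─ st , refl) , λ C cover →
      ℕ.+-cancelʳ-≤ ∣ S ∣ _ _
        (subst (_≤ ∣ C ∣ + ∣ S ∣) (sym (∣p─q∣+∣q∣≡∣p∣ W S S⊆W)) (∣W∣≤∣VertexCover∣+β β cover))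

module _ {n : ℕ} (G : Graph n) (x : Fin n) where

  V∖x V∖N[x] : Subset n
  V∖x    = ∁ ⁅ x ⁆
  V∖N[x] = ∁ (N[_] G x)

  ∈V∖x⁺ : ∀ {v} → v ≢ x → v ∈ V∖x
  ∈V∖x⁺ = x∉p⇒x∈∁p ∘ x≢y⇒x∉⁅y⁆

  ∈V∖x⁻ : ∀ {v} → v ∈ V∖x → v ≢ x
  ∈V∖x⁻ = x∉⁅y⁆⇒x≢y ∘ x∈∁p⇒x∉p

  ∈V∖N[x]⁺ : ∀ {v} → v ≢ x → ¬ Adj G x v → v ∈ V∖N[x]
  ∈V∖N[x]⁺ v≢x ¬xv = x∉p⇒x∈∁p λ v∈N[x] →
    [ ¬xv ∘ ∈N⁅x⁆⁻ G , v≢x ∘ x∈⁅y⁆⇒x≡y x ]′ (x∈p∪q⁻ (N G ⁅ x ⁆) ⁅ x ⁆ v∈N[x])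

  ∈V∖N[x]⁻ : ∀ {v} → v ∈ V∖N[x] → v ≢ x × ¬ Adj G x v
  ∈V∖N[x]⁻ v∈V∖N[x] =
      (λ { refl → x∈∁p⇒x∉p v∈V∖N[x] (x∈p∪q⁺ (inj₂ (x∈⁅x⁆ x))) })
    , (λ xv → x∈∁p⇒x∉p v∈V∖N[x] (x∈p∪q⁺ (inj₁ (∈N⁅x⁆⁺ G xv))))

  V∖N[x]⊆V∖x : V∖N[x] ⊆ V∖x
  V∖N[x]⊆V∖x = ∈V∖x⁺ ∘ proj₁ ∘ ∈V∖N[x]⁻

  x∉V∖N[x] : x ∉ V∖N[x]
  x∉V∖N[x] x∈V∖N[x] = proj₁ (∈V∖N[x]⁻ x∈V∖N[x]) refl

  ∣V∖x∣+1≡n : ∣ V∖x ∣ + 1 ≡ n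
  ∣V∖x∣+1≡n = trans (cong (_+ 1) (trans (∣∁p∣≡n∸∣p∣ ⁅ x ⁆) (cong (n ∸_) (∣⁅x⁆∣≡1 x))))
    (ℕ.m∸n+n≡m (subst (1 ≤_) (∣⊤∣≡n n) (x∈p⇒1≤∣p∣ (∈⊤ {x = x}))))

  condB⇒shedding : CondB G x → Shedding G x
  condB⇒shedding condB S stS@(S⊆V∖N[x] , _) maximalS
    with 1≤∣p∣⇒Nonempty _ (condB S stS)
  ... | y , y∈N⁅x⁆─NS = MaximalStable⇒¬Addable G maximalS
    ( ∈V∖x⁺ (λ { refl → Adj-irrefl G xy })
    , (λ y∈S → proj₂ (∈V∖N[x]⁻ (S⊆V∖N[x] y∈S)) xy)
    , λ u u∈S uy → x∈p─q⇒x∉q (N G ⁅ x ⁆) (N G S) y∈N⁅x⁆─NS (∈N⁺ G S u∈S uy) )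
    where xy = ∈N⁅x⁆⁻ G (p─q⊆p (N G ⁅ x ⁆) (N G S) y∈N⁅x⁆─NS)

  -- Extend S to a maximal stable set T of G ∖ N[x]; a vertex that can be added to T
  -- in G ∖ x must be a neighbour of x outside N(T) ⊇ N(S).
  shedding⇒condB : Shedding G x → CondB G x
  shedding⇒condB shedding S stS with extendToMaximal G stS
  ... | T , maximalT@(stT , _) , S⊆T
    with ¬MaximalStable⇒Addable G (Stable-mono G V∖N[x]⊆V∖x stT) (shedding T stT)
  ... | y , y∈V∖x , y∉T , y∉N[T] with adj? G x y
  ...   | no ¬xy = contradiction (∈V∖N[x]⁺ (∈V∖x⁻ y∈V∖x) ¬xy , y∉T , y∉N[T])
                     (MaximalStable⇒¬Addable G maximalT)
  ...   | yes xy = x∈p⇒1≤∣p∣ (x∈p∧x∉q⇒x∈p─q (∈N⁅x⁆⁺ G xy) λ y∈NS →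
                     let u , u∈S , uy = ∈N⁻ G S y∈NS in y∉N[T] u (S⊆T u∈S) uy)

  -- The only vertex that could enlarge T in G is x, and it can do so only if T avoids N[x].
  shedding⇒MaximalStable : Shedding G x → ∀ {T} → MaximalStable G V∖x T → MaximalStable G ⊤ T
  shedding⇒MaximalStable shedding {T} maximalT@(stT@(T⊆V∖x , indepT) , _) =
    ¬Addable⇒MaximalStable G (Stable-mono G (λ _ → ∈⊤) stT) ¬addable
    where
    ¬addable : ∀ v → ¬ Addable G ⊤ T v
    ¬addable v (_ , v∉T , v∉N[T]) with v ≟ x
    ... | no v≢x = MaximalStable⇒¬Addable G maximalT (∈V∖x⁺ v≢x , v∉T , v∉N[T])
    ... | yes refl = shedding T (T⊆V∖N[x] , indepT) maximalT
      where
      T⊆V∖N[x] : T ⊆ V∖N[x]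
      T⊆V∖N[x] u∈T = ∈V∖N[x]⁺ (∈V∖x⁻ (T⊆V∖x u∈T)) (v∉N[T] _ u∈T ∘ Adj-sym G)

  MaximalStable-∪⁅x⁆ : ∀ {S} → S ⊆ V∖N[x] → MaximalStable G V∖x S → MaximalStable G ⊤ (S ∪ ⁅ x ⁆)
  MaximalStable-∪⁅x⁆ {S} S⊆V∖N[x] maximalS@(stS , _) = ¬Addable⇒MaximalStable G stS∪x ¬addable
    where
    x∉S : x ∉ S
    x∉S = x∉V∖N[x] ∘ S⊆V∖N[x]
    stS∪x : Stable G ⊤ (S ∪ ⁅ x ⁆)
    stS∪x = Stable-∪⁅⁆ G (Stable-mono G (λ _ → ∈⊤) stS)
      (∈⊤ , x∉S , λ u u∈S ux → proj₂ (∈V∖N[x]⁻ (S⊆V∖N[x] u∈S)) (Adj-sym G ux))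
    ¬addable : ∀ v → ¬ Addable G ⊤ (S ∪ ⁅ x ⁆) v
    ¬addable v (_ , v∉S∪x , v∉N[S∪x]) = MaximalStable⇒¬Addable G maximalS
      ( ∈V∖x⁺ (λ { refl → v∉S∪x (x∈p∪q⁺ (inj₂ (x∈⁅x⁆ x))) })
      , v∉S∪x ∘ p⊆p∪q {p = S} ⁅ x ⁆
      , λ u → v∉N[S∪x] u ∘ p⊆p∪q {p = S} ⁅ x ⁆ )

  shedding⇒extendable : Unmixed G ⊤ → Shedding G x → Extendable G x
  shedding⇒extendable unmixed shedding =
      unmixed
    , (λ S T maximalS maximalT → unmixed S T (lift maximalS) (lift maximalT))
    , λ a b βG βG∖x@((_ , _ , ∣S∣≡b) , _) →
        trans (sym (Unmixed⇒∣MaximalStable∣≡β G unmixed (lift (IsBeta⇒MaximalStable G βG∖x)) βG)) ∣S∣≡b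
    where lift = shedding⇒MaximalStable shedding

  extendable⇒shedding : Extendable G x → Shedding G x
  extendable⇒shedding (unmixed , unmixedG∖x , β≡) S (S⊆V∖N[x] , _) maximalS
    with β-exists G ⊤ | β-exists G V∖x
  ... | a , βG | b , βG∖x = ℕ.<-irrefl ∣S∣≡∣S∪x∣ (p⊂q⇒∣p∣<∣q∣ (x∉p⇒p⊂p∪⁅x⁆ x∉S))
    where
    x∉S : x ∉ S
    x∉S = x∉V∖N[x] ∘ S⊆V∖N[x]
    ∣S∣≡∣S∪x∣ : ∣ S ∣ ≡ ∣ S ∪ ⁅ x ⁆ ∣
    ∣S∣≡∣S∪x∣ = trans (Unmixed⇒∣MaximalStable∣≡β G unmixedG∖x maximalS βG∖x)
      (sym (trans (Unmixed⇒∣MaximalStable∣≡β G unmixed (MaximalStable-∪⁅x⁆ S⊆V∖N[x] maximalS) βG)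
                  (β≡ a b βG βG∖x)))

  τ+β-delete : ∀ {t a t′ b} → IsTau G ⊤ t → IsBeta G ⊤ a → IsTau G V∖x t′ → IsBeta G V∖x b →
               t + a ≡ suc (t′ + b)
  τ+β-delete {t} {a} {t′} {b} τG βG τG∖x βG∖x = begin
    t + a           ≡⟨ trans (τ+β≡∣W∣ G τG βG) (∣⊤∣≡n n) ⟩
    n               ≡⟨ sym ∣V∖x∣+1≡n ⟩
    ∣ V∖x ∣ + 1     ≡⟨ cong (_+ 1) (sym (τ+β≡∣W∣ G τG∖x βG∖x)) ⟩
    t′ + b + 1      ≡⟨ ℕ.+-comm (t′ + b) 1 ⟩
    suc (t′ + b)    ∎
    where open ≡-Reasoning

  extendable⇒critical×unmixed : Extendable G x → Critical G x × Unmixed G V∖x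
  extendable⇒critical×unmixed (_ , unmixedG∖x , β≡) = critical , unmixedG∖x
    where
    critical : Critical G x
    critical t′ t τG∖x τG with β-exists G ⊤ | β-exists G V∖x
    ... | a , βG | b , βG∖x = ℕ.≤-reflexive (sym (ℕ.+-cancelʳ-≡ b t (suc t′) t+b≡1+t′+b))
      where
      t+b≡1+t′+b : t + b ≡ suc t′ + b
      t+b≡1+t′+b = trans (cong (t +_) (sym (β≡ a b βG βG∖x))) (τ+β-delete τG βG τG∖x βG∖x)

  critical⇒extendable : Unmixed G ⊤ → Critical G x × Unmixed G V∖x → Extendable G x
  critical⇒extendable unmixed (critical , unmixedG∖x) = unmixed , unmixedG∖x , β≡
    where
    β≡ : ∀ a b → IsBeta G ⊤ a → IsBeta G V∖x b → a ≡ b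
    β≡ a b βG βG∖x with τ-exists G V∖x | τ-exists G ⊤
    ... | t′ , τG∖x | t , τG = ℕ.≤-antisym a≤b (IsBeta-mono G (λ _ → ∈⊤) βG∖x βG)
      where
      a≤b : a ≤ b
      a≤b = ℕ.+-cancelˡ-≤ (suc t′) a b (subst (suc t′ + a ≤_) (τ+β-delete τG βG τG∖x βG∖x)
              (ℕ.+-monoˡ-≤ a (critical t′ t τG∖x τG)))

mainTheorem16 : ∀ {n : ℕ} (G : Graph n) (x : Fin n) → Unmixed G ⊤
    → (Extendable G x ⇔ CondB G x)
      × (CondB G x ⇔ Shedding G x)
      × (Shedding G x ⇔ (Critical G x × Unmixed G (∁ ⁅ x ⁆)))
mainTheorem16 G x unmixed =
    mk⇔ (shedding⇒condB G x ∘ extendable⇒shedding G x) (shedding⇒extendable G x unmixed ∘ condB⇒shedding G x)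
  , mk⇔ (condB⇒shedding G x) (shedding⇒condB G x)
  , mk⇔ (extendable⇒critical×unmixed G x ∘ shedding⇒extendable G x unmixed)
        (extendable⇒shedding G x ∘ critical⇒extendable G x unmixed)
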